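{- Let $G$ be a connected graph, let $\sigma=\{(A_i,B_i)\mid i\in I\}$ be an infinite star of oriented separations in $\mathcal{B}_{\aleph_0}(G)$, and let $i_*\in I$. Then there is an infinite subset $J\subseteq I$ with $i_*\in J$ such that the part $\bigcap_{j\in J}B_j$ of the substar $\{(A_j,B_j)\mid j\in J\}$ induces a connected subgraph of $G$.
   Context: Graphs are simple and may be infinite. $\mathcal{B}_{\aleph_0}(G)$ is the set of unordered bipartitions $\{A,B\}$ of $V(G)$ induced by finite bonds of $G$, i.e. $A\cup B=V(G)$, $A\cap B=\emptyset$, $A,B\neq\emptyset$, both $G[A]$ and $G[B]$ are connected, and the set $E(A,B)$ of $A$–$B$ edges of $G$ is finite. Its oriented separations are the ordered pairs $(A,B)$ and $(B,A)$; they are partially ordered by $(A,B)\le(C,D)$ iff $A\subseteq C$ and $B\supseteq D$. A star is a set of oriented separations such that $(A,B)\le(D,C)$ for any two distinct members $(A,B),(C,D)$. Here the $(A_i,B_i)$, $i\in I$, are pairwise distinct oriented separations with $\{A_i,B_i\}\in\mathcal B_{\aleph_0}(G)$. The part of a star $\{(A_i,B_i)\mid i\in I\}$ is $\bigcap_{i\in I}B_i$. -}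

module Defs where

open import Level using (0ℓ)
open import Data.Empty using (⊥)
open import Data.Unit using (⊤)
open import Data.Product using (Σ; ∃; _×_; _,_)
open import Data.Sum using (_⊎_)
open import Data.List using (List)
open import Data.List.Membership.Propositional using (_∈_)
open import Relation.Nullary using (¬_)
open import Relation.Binary.PropositionalEquality using (_≡_)

record Graph : Set₁ where
  field
    V     : Set
    Adj   : V → V → Set
    sym   : ∀ {u v} → Adj u v → Adj v u
    irrefl : ∀ {v} → ¬ Adj v v
open Graph public

Subset : Set → Set₁
Subset X = X → Set

_⊆_ : {X : Set} → Subset X → Subset X → Set
A ⊆ B = ∀ x → A x → B x

FiniteSub : {X : Set} → Subset X → Set
FiniteSub {X} J = Σ (List X) λ l → ∀ x → J x → x ∈ l

InfiniteSub : {X : Set} → Subset X → Set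
InfiniteSub J = ¬ FiniteSub J

InfiniteType : Set → Set
InfiniteType X = InfiniteSub {X} (λ _ → X)

module _ (G : Graph) where
  data ReachIn (A : Subset (V G)) (u : V G) : V G → Set where
    here : A u → ReachIn A u u
    step : ∀ {w v} → ReachIn A u w → Adj G w v → A v → ReachIn A u v

  -- G[A] is connected (Diestel convention: non-empty)
  ConnectedIn : Subset (V G) → Set
  ConnectedIn A = (∃ λ v → A v) × (∀ u v → A u → A v → ReachIn A u v)

  Connected : Set
  Connected = ConnectedIn (λ _ → ⊤)

  FiniteCut : Subset (V G) → Subset (V G) → Set
  FiniteCut A B = Σ (List (V G × V G)) λ l →
    ∀ a b → A a → B b → Adj G a b → (a , b) ∈ l

  IsFinBond : Subset (V G) → Subset (V G) → Set
  IsFinBond A B =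
    (∀ v → A v ⊎ B v) × (∀ v → A v → B v → ⊥) ×
    (∃ λ v → A v) × (∃ λ v → B v) ×
    ConnectedIn A × ConnectedIn B × FiniteCut A B

  _≤ₛ_ : (Subset (V G) × Subset (V G)) → (Subset (V G) × Subset (V G)) → Set
  (A , B) ≤ₛ (C , D) = (A ⊆ C) × (D ⊆ B)

  SameSep : (Subset (V G) × Subset (V G)) → (Subset (V G) × Subset (V G)) → Set
  SameSep (A , B) (C , D) = (A ⊆ C) × (C ⊆ A) × (B ⊆ D) × (D ⊆ B)

  IsStar : {I : Set} → (I → Subset (V G)) → (I → Subset (V G)) → Set
  IsStar {I} As Bs =
    (∀ i → IsFinBond (As i) (Bs i)) ×
    (∀ i j → ¬ i ≡ j → ¬ SameSep (As i , Bs i) (As j , Bs j)) ×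
    (∀ i j → ¬ i ≡ j → (As i , Bs i) ≤ₛ (Bs j , As j))

  Part : {I : Set} → (I → Subset (V G)) → Subset I → Subset (V G)
  Part Bs J v = ∀ j → J j → Bs j v

-- Grow J one index at a time, keeping a finite set K of vertices (the skeleton) of the
-- current part that contains a root r ∈ B_{i*} and, for every chosen j,
-- walks inside K from r to each endpoint in the part of the finitely many
-- edges of E(A_j, B_j).  Then the part is connected: a walk from r inside
-- some B_k can be rerouted at its last vertex outside the part, which lies
-- in some A_j, so the edge leaving it is such an anchored cut edge.  A new
-- index j keeps the invariant as long as A_j misses K; since the A_j of a
-- star are pairwise disjoint, only finitely many indices are excluded, and
-- the finitely many new cut edges of j are anchored in turn.
module Submission where

open import Defs
open import Level using (0ℓ)
open import Axiom.ExcludedMiddle using (ExcludedMiddle)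
open import Data.Empty using (⊥; ⊥-elim)
open import Data.Product using (Σ; ∃; ∃₂; _×_; _,_; proj₁; proj₂)
open import Data.Sum using (_⊎_; [_,_]′)
open import Data.Nat using (ℕ; zero; suc; _<_; _≤_; _≤′_; ≤′-refl; ≤′-step; _⊔_)
open import Data.Nat.Properties using (n<1+n; ≤⇒≤′; m≤m⊔n; m≤n⊔m)
open import Data.List using (List; []; _∷_; _++_; map; length; lookup)
open import Data.List.Relation.Unary.Any using (here; there; index)
open import Data.List.Relation.Unary.Any.Properties using (lookup-index)
open import Data.List.Membership.Propositional using (_∈_; _∉_)
open import Data.List.Membership.Propositional.Properties
  using (∈-++⁺ˡ; ∈-++⁺ʳ; ∈-++⁻; ∈-map⁺)
open import Data.Fin as Fin using (Fin; toℕ)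
open import Data.Fin.Properties using (pigeonhole)
open import Relation.Nullary using (¬_; yes; no)
open import Relation.Binary.PropositionalEquality
  using (_≡_; _≢_; refl; cong; subst; module ≡-Reasoning)
  renaming (sym to ≡-sym)

infinite-of-injection : {X : Set} {J : Subset X} (f : ℕ → X) →
  (∀ n → J (f n)) → (∀ {m n} → m < n → f m ≢ f n) → InfiniteSub J
infinite-of-injection {J = J} f f∈J f-inj (l , J⊆l) =
  collision (pigeonhole (n<1+n (length l)) position)
  where
  position : Fin (suc (length l)) → Fin (length l)
  position k = index (J⊆l (f (toℕ k)) (f∈J (toℕ k)))

  collision : ∃₂ (λ k₁ k₂ → k₁ Fin.< k₂ × position k₁ ≡ position k₂) → ⊥
  collision (k₁ , k₂ , k₁<k₂ , same) = f-inj k₁<k₂ (begin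
    f (toℕ k₁)              ≡⟨ lookup-index (J⊆l _ (f∈J (toℕ k₁))) ⟩
    lookup l (position k₁)  ≡⟨ cong (lookup l) same ⟩
    lookup l (position k₂)  ≡⟨ ≡-sym (lookup-index (J⊆l _ (f∈J (toℕ k₂)))) ⟩
    f (toℕ k₂)              ∎)
    where open ≡-Reasoning

module Walks (G : Graph) where

  ReachIn-target : ∀ {A u v} → ReachIn G A u v → A v
  ReachIn-target (here a)     = a
  ReachIn-target (step _ _ a) = a

  ReachIn-mono : ∀ {A B u v} → A ⊆ B → ReachIn G A u v → ReachIn G B u v
  ReachIn-mono A⊆B (here a)     = here (A⊆B _ a)
  ReachIn-mono A⊆B (step p e a) = step (ReachIn-mono A⊆B p) e (A⊆B _ a)

  ReachIn-trans : ∀ {A u w v} → ReachIn G A u w → ReachIn G A w v → ReachIn G A u v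
  ReachIn-trans p (here _)     = p
  ReachIn-trans p (step q e a) = step (ReachIn-trans p q) e a

  ReachIn-sym : ∀ {A u v} → ReachIn G A u v → ReachIn G A v u
  ReachIn-sym (here a)     = here a
  ReachIn-sym (step p e a) =
    ReachIn-trans (step (here a) (sym G e) (ReachIn-target p)) (ReachIn-sym p)

  rooted⇒ConnectedIn : ∀ {A r} → A r → (∀ v → A v → ReachIn G A r v) → ConnectedIn G A
  rooted⇒ConnectedIn {r = r} Ar reach =
    (r , Ar) , λ u v Au Av → ReachIn-trans (ReachIn-sym (reach u Au)) (reach v Av)

  ReachIn-finite : ∀ {A u v} → ReachIn G A u v →
    Σ (List (V G)) λ L → (_∈ L) ⊆ A × ReachIn G (_∈ L) u v
  ReachIn-finite {u = u} (here a) =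
    u ∷ [] , (λ { _ (here refl) → a }) , here (here refl)
  ReachIn-finite (step {v = v} p e a) with ReachIn-finite p
  ... | L , L⊆A , q =
    v ∷ L , (λ { _ (here refl) → a ; x (there x∈L) → L⊆A x x∈L }) ,
    step (ReachIn-mono (λ _ → there) q) e (here refl)

  ReachIn-finite-targets : ExcludedMiddle 0ℓ → ∀ {A r} →
    (∀ v → A v → ReachIn G A r v) → (ts : List (V G)) →
    Σ (List (V G)) λ L → (_∈ L) ⊆ A × (∀ v → v ∈ ts → A v → ReachIn G (_∈ L) r v)
  ReachIn-finite-targets lem reach [] = [] , (λ _ ()) , (λ _ ())
  ReachIn-finite-targets lem {A} reach (t ∷ ts)
    with lem {A t} | ReachIn-finite-targets lem reach ts
  ... | no ¬At | L , L⊆A , reachL =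
    L , L⊆A , λ { _ (here refl) At → ⊥-elim (¬At At) ; v (there v∈ts) Av → reachL v v∈ts Av }
  ... | yes At | L , L⊆A , reachL with ReachIn-finite (reach t At)
  ...   | M , M⊆A , q =
    M ++ L ,
    (λ x x∈ → [ M⊆A x , L⊆A x ]′ (∈-++⁻ M x∈)) ,
    λ { _ (here refl) _ → ReachIn-mono (λ _ → ∈-++⁺ˡ) q
      ; v (there v∈ts) Av → ReachIn-mono (λ _ → ∈-++⁺ʳ M) (reachL v v∈ts Av) }

module StarFacts (lem : ExcludedMiddle 0ℓ) (G : Graph) {I : Set}
                 (As Bs : I → Subset (V G)) (star : IsStar G As Bs) where
  open Walks G

  cover : ∀ i v → As i v ⊎ Bs i v
  cover i with proj₁ star i
  ... | c , _ = c

  disjoint : ∀ i v → As i v → Bs i v → ⊥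
  disjoint i with proj₁ star i
  ... | _ , d , _ = d

  Bs-walk : ∀ i {u v} → Bs i u → Bs i v → ReachIn G (Bs i) u v
  Bs-walk i {u} {v} with proj₁ star i
  ... | _ , _ , _ , _ , _ , (_ , conn) , _ = conn u v

  cut : I → List (V G × V G)
  cut i with proj₁ star i
  ... | _ , _ , _ , _ , _ , _ , (l , _) = l

  cut-complete : ∀ i a b → As i a → Bs i b → Adj G a b → (a , b) ∈ cut i
  cut-complete i with proj₁ star i
  ... | _ , _ , _ , _ , _ , _ , (_ , complete) = complete

  As⊆Bs : ∀ i j → i ≢ j → As i ⊆ Bs j
  As⊆Bs i j i≢j = proj₁ (proj₂ (proj₂ star) i j i≢j)

  Bs-of-¬As : ∀ i v → ¬ As i v → Bs i v
  Bs-of-¬As i v ¬A = [ (λ A → ⊥-elim (¬A A)) , (λ B → B) ]′ (cover i v)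

  As-unique : ∀ {i j x} → As i x → As j x → i ≡ j
  As-unique {i} {j} {x} Ai Aj with lem {i ≡ j}
  ... | yes i≡j = i≡j
  ... | no  i≢j = ⊥-elim (disjoint j x Aj (As⊆Bs i j i≢j x Ai))

  owners : List (V G) → List I
  owners [] = []
  owners (x ∷ xs) with lem {∃ λ i → As i x}
  ... | yes (i , _) = i ∷ owners xs
  ... | no _        = owners xs

  owners-complete : ∀ {i x} xs → x ∈ xs → As i x → i ∈ owners xs
  owners-complete (y ∷ xs) x∈ Ai with lem {∃ λ i → As i y} | x∈
  ... | yes (j , Aj) | here refl = here (As-unique Ai Aj)
  ... | yes _        | there x∈xs = there (owners-complete xs x∈xs Ai)
  ... | no none      | here refl = ⊥-elim (none (_ , Ai))
  ... | no _         | there x∈xs = owners-complete xs x∈xs Ai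

  fresh-index : InfiniteType I → (is : List I) (xs : List (V G)) →
    ∃ λ j → j ∉ is × (∀ x → x ∈ xs → ¬ As j x)
  fresh-index inf is xs with lem {∃ λ j → j ∉ is × (∀ x → x ∈ xs → ¬ As j x)}
  ... | yes found = found
  ... | no none   = ⊥-elim (inf (is ++ owners xs , covered))
    where
    covered : ∀ i → I → i ∈ is ++ owners xs
    covered i _ with lem {i ∈ is}
    ... | yes i∈is = ∈-++⁺ˡ i∈is
    ... | no  i∉is with lem {∃ λ x → x ∈ xs × As i x}
    ...   | yes (x , x∈xs , Ai) = ∈-++⁺ʳ is (owners-complete xs x∈xs Ai)
    ...   | no  free = ⊥-elim (none (i , i∉is , λ x x∈xs Ai → free (x , x∈xs , Ai)))

  Part-anti : ∀ {S T} → S ⊆ T → Part G Bs T ⊆ Part G Bs S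
  Part-anti S⊆T v Pv j Sj = Pv j (S⊆T j Sj)

  outside-Part : ∀ {S w} → ¬ Part G Bs S w → ∃ λ j → S j × As j w
  outside-Part {S} {w} ¬Pw with lem {∃ λ j → S j × As j w}
  ... | yes found = found
  ... | no none   = ⊥-elim (¬Pw λ j Sj → Bs-of-¬As j w λ Aw → none (j , Sj , Aw))

  module Rooted (r : V G) where

    Anchored : Subset I → I → Subset (V G) → Set
    Anchored S j Q = ∀ a v → As j a → Adj G a v → Part G Bs S v → ReachIn G Q r v

    Anchored-mono : ∀ {S T j Q R} → S ⊆ T → Q ⊆ R → Anchored S j Q → Anchored T j R
    Anchored-mono S⊆T Q⊆R anchored a v Aa e Pv =
      ReachIn-mono Q⊆R (anchored a v Aa e (Part-anti S⊆T v Pv))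

    -- The last vertex w of the walk outside the part lies in some A_j with
    -- j ≠ k (as w ∈ B_k), and the following edge is an anchored cut edge of j.
    reroute-into-Part : (S : Subset I) (k : I) →
      (∀ j → S j → j ≢ k → Anchored S j (Part G Bs S)) →
      ∀ {v} → ReachIn G (Bs k) r v → Part G Bs S v → ReachIn G (Part G Bs S) r v
    reroute-into-Part S k anchored (here _) Pv = here Pv
    reroute-into-Part S k anchored (step {w} p e _) Pv with lem {Part G Bs S w}
    ... | yes Pw = step (reroute-into-Part S k anchored p Pw) e Pv
    ... | no ¬Pw with outside-Part ¬Pw
    ...   | j , Sj , Aw = anchored j Sj j≢k w _ Aw e Pv
      where
      j≢k : j ≢ k
      j≢k refl = disjoint j w Aw (ReachIn-target p)

module Construction (lem : ExcludedMiddle 0ℓ) (G : Graph) {I : Set}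
                    (As Bs : I → Subset (V G)) (star : IsStar G As Bs)
                    (inf : InfiniteType I) (i* : I) where
  open Walks G
  open StarFacts lem G As Bs star

  r : V G
  r with proj₁ star i*
  ... | _ , _ , _ , (v , _) , _ = v

  r∈Bs : Bs i* r
  r∈Bs with proj₁ star i*
  ... | _ , _ , _ , (_ , Bv) , _ = Bv

  open Rooted r

  record Stage : Set where
    field
      indices       : List I
      skeleton      : List (V G)
      root∈skeleton : r ∈ skeleton
      skeleton⊆Part : (_∈ skeleton) ⊆ Part G Bs (_∈ indices)
      anchored      : ∀ j → j ∈ indices → Anchored (_∈ indices) j (_∈ skeleton)
  open Stage

  initial : Stage
  initial = record
    { indices       = []
    ; skeleton      = r ∷ []
    ; root∈skeleton = here refl
    ; skeleton⊆Part = λ _ _ _ ()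
    ; anchored      = λ _ ()
    }

  module Extend (s : Stage) (j : I) (avoid : ∀ x → x ∈ skeleton s → ¬ As j x) where

    S : Subset I
    S = _∈ j ∷ indices s

    skeleton⊆Part′ : (_∈ skeleton s) ⊆ Part G Bs S
    skeleton⊆Part′ x x∈ _ (here refl) = Bs-of-¬As j x (avoid x x∈)
    skeleton⊆Part′ x x∈ j′ (there j′∈) = skeleton⊆Part s x x∈ j′ j′∈

    r∈Part : Part G Bs S r
    r∈Part = skeleton⊆Part′ r (root∈skeleton s)

    Part-rooted : ∀ v → Part G Bs S v → ReachIn G (Part G Bs S) r v
    Part-rooted v Pv =
      reroute-into-Part S j old-anchored (Bs-walk j (r∈Part j (here refl)) (Pv j (here refl))) Pv
      where
      old-anchored : ∀ j′ → S j′ → j′ ≢ j → Anchored S j′ (Part G Bs S)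
      old-anchored _ (here refl)  j≢j = ⊥-elim (j≢j refl)
      old-anchored j′ (there j′∈) _   =
        Anchored-mono (λ _ → there) skeleton⊆Part′ (anchored s j′ j′∈)

    cut-walks : Σ (List (V G)) λ L → (_∈ L) ⊆ Part G Bs S ×
      (∀ v → v ∈ map proj₂ (cut j) → Part G Bs S v → ReachIn G (_∈ L) r v)
    cut-walks = ReachIn-finite-targets lem Part-rooted (map proj₂ (cut j))

    added : List (V G)
    added = proj₁ cut-walks

    stage′ : Stage
    stage′ = record
      { indices       = j ∷ indices s
      ; skeleton      = skeleton s ++ added
      ; root∈skeleton = ∈-++⁺ˡ (root∈skeleton s)
      ; skeleton⊆Part = λ x x∈ →
          [ skeleton⊆Part′ x , proj₁ (proj₂ cut-walks) x ]′ (∈-++⁻ (skeleton s) x∈)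
      ; anchored      = anchored′
      }
      where
      anchored′ : ∀ j′ → S j′ → Anchored S j′ (_∈ skeleton s ++ added)
      anchored′ _ (here refl) a v Aa e Pv =
        ReachIn-mono (λ _ → ∈-++⁺ʳ (skeleton s))
          (proj₂ (proj₂ cut-walks) v
            (∈-map⁺ proj₂ (cut-complete j a v Aa (Pv j (here refl)) e)) Pv)
      anchored′ j′ (there j′∈) =
        Anchored-mono (λ _ → there) (λ _ → ∈-++⁺ˡ) (anchored s j′ j′∈)

  extend : (s : Stage) (j : I) → (∀ x → x ∈ skeleton s → ¬ As j x) → Stage
  extend = Extend.stage′

  fresh : (s : Stage) → ∃ λ j → j ∉ indices s × (∀ x → x ∈ skeleton s → ¬ As j x)
  fresh s = fresh-index inf (indices s) (skeleton s)

  stage : ℕ → Stage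
  stage zero    = extend initial i* λ { _ (here refl) Ar → disjoint i* r Ar r∈Bs }
  stage (suc n) = extend (stage n) (proj₁ (fresh (stage n))) (proj₂ (proj₂ (fresh (stage n))))

  pick : ℕ → I
  pick n = proj₁ (fresh (stage n))

  indices-mono : ∀ {m n} → m ≤ n → (_∈ indices (stage m)) ⊆ (_∈ indices (stage n))
  indices-mono m≤n = go (≤⇒≤′ m≤n)
    where
    go : ∀ {m n} → m ≤′ n → (_∈ indices (stage m)) ⊆ (_∈ indices (stage n))
    go ≤′-refl       _ i∈ = i∈
    go (≤′-step m≤′n) i i∈ = there (go m≤′n i i∈)

  skeleton-mono : ∀ {m n} → m ≤ n → (_∈ skeleton (stage m)) ⊆ (_∈ skeleton (stage n))
  skeleton-mono m≤n = go (≤⇒≤′ m≤n)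
    where
    go : ∀ {m n} → m ≤′ n → (_∈ skeleton (stage m)) ⊆ (_∈ skeleton (stage n))
    go ≤′-refl       _ x∈ = x∈
    go (≤′-step m≤′n) x x∈ = ∈-++⁺ˡ (go m≤′n x x∈)

  J : Subset I
  J i = ∃ λ n → i ∈ indices (stage n)

  pick-injective : ∀ {m n} → m < n → pick m ≢ pick n
  pick-injective {m} {n} m<n pm≡pn =
    proj₁ (proj₂ (fresh (stage n)))
      (subst (_∈ indices (stage n)) pm≡pn (indices-mono m<n (pick m) (here refl)))

  J-infinite : InfiniteSub J
  J-infinite = infinite-of-injection pick (λ n → suc n , here refl) pick-injective

  skeleton⊆Part-J : ∀ n → (_∈ skeleton (stage n)) ⊆ Part G Bs J
  skeleton⊆Part-J n x x∈ j (k , j∈) =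
    skeleton⊆Part (stage (n ⊔ k)) x (skeleton-mono (m≤m⊔n n k) x x∈) j
      (indices-mono (m≤n⊔m n k) j j∈)

  Part-J-rooted : ∀ v → Part G Bs J v → ReachIn G (Part G Bs J) r v
  Part-J-rooted v Pv = reroute-into-Part J i* J-anchored (Bs-walk i* r∈Bs (Pv i* (0 , here refl))) Pv
    where
    J-anchored : ∀ j → J j → j ≢ i* → Anchored J j (Part G Bs J)
    J-anchored j (n , j∈) _ =
      Anchored-mono (λ i i∈ → n , i∈) (skeleton⊆Part-J n) (anchored (stage n) j j∈)

  Part-J-connected : ConnectedIn G (Part G Bs J)
  Part-J-connected =
    rooted⇒ConnectedIn (skeleton⊆Part-J 0 r (root∈skeleton (stage 0))) Part-J-rooted

lemma5p2 : ExcludedMiddle 0ℓ →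
    (G : Graph) → Connected G →
    (I : Set) → (As Bs : I → Subset (V G)) →
    IsStar G As Bs → InfiniteType I →
    (i* : I) →
    Σ (Subset I) λ J → J i* × InfiniteSub J × ConnectedIn G (Part G Bs J)
lemma5p2 lem G _ I As Bs star inf i* = J , (0 , here refl) , J-infinite , Part-J-connected
  where open Construction lem G As Bs star inf i*
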